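{- Let $\mathbf{M}$ be any $W$-model and $w$ a possible world of its frame. Then for all formulas $\varphi,\psi$: (1) $(\mathbf{M},w)\models\neg\varphi$ iff $(\mathbf{M},w)\not\models\varphi$; (2) $(\mathbf{M},w)\models\varphi\to\psi$ iff $(\mathbf{M},w)\not\models\varphi$ or $(\mathbf{M},w)\models\psi$.
   Context: Language: a countable set $Pr$ of propositional variables, binary connectives $\land,\lor,\to$ and unary connectives $\neg,\Box,\Box_L$. A frame is $F=(S,\leq,R,*,Q,Q_L)$ where $(S,\leq)$ is a partially ordered set; $R\subseteq S^3$ satisfies: if $Rstu$, $s'\leq s$, $t'\leq t$, $u\leq u'$ then $Rs't'u'$; $*:S\to S$ satisfies $s\leq t\Rightarrow t^*\leq s^*$; $Q,Q_L\subseteq S^2$ satisfy: if $Qst$, $s'\leq s$, $t\leq t'$ then $Qs't'$ (same for $Q_L$). A valuation $V$ assigns to each $p$ an up-set. Interpretation: $[\![p]\!]=V(p)$; $\land$ intersection, $\lor$ union; $[\![\neg\varphi]\!]=\{s: s^*\notin[\![\varphi]\!]\}$; $[\![\varphi\to\psi]\!]=\{s:\forall t,u\,(Rstu \text{ and } t\in[\![\varphi]\!]\Rightarrow u\in[\![\psi]\!])\}$; $[\![\Box\varphi]\!]=\{s:\forall t\,(Qst\Rightarrow t\in[\![\varphi]\!])\}$; $[\![\Box_L\varphi]\!]$ likewise with $Q_L$. Write $(\mathbf{M},s)\models\varphi$ for $s\in[\![\varphi]\!]$. A frame is bounded if $(S,\le)$ has least element $0$ and greatest element $1$ and: $1^*=0$,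 $0^*=1$; $Q00$, $Q_L00$; $Q1s\Rightarrow s=1$, $Q_L1s\Rightarrow s=1$; $R010$; $R1st\Rightarrow(s=0$ or $t=1)$. In a bounded frame, $w\in S$ is a possible world if $w^*=w$, $Rwww$, and for all $s,t$: $Rwst\Rightarrow(s=0$ or $w\le t)$ and $Rwst\Rightarrow(t=1$ or $s\le w^*)$. A $W$-frame is $(F,W)$ with $F$ a bounded frame and $W\subseteq S$ a set of possible worlds such that (a) for all $w\in W$ and all $s,t,u$: if $Q_Lwu$ and $Rust$ then $s\le t$; (b) for every $s$ there are $w\in W$ and $u$ with $Q_Lwu$ and $Russ$. A $W$-model is a $W$-frame with a valuation $V$ such that each $V(p)$ is an up-set with $1\in V(p)$ and $0\notin V(p)$. -}

module Defs where

open import Data.Nat using (ℕ)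
open import Data.Product using (_×_; Σ; ∃)
open import Data.Sum using (_⊎_)
open import Relation.Nullary using (¬_)
open import Relation.Binary.PropositionalEquality using (_≡_)
open import Relation.Binary.Structures using (IsPartialOrder)

Pr : Set
Pr = ℕ

data Formula : Set where
  var  : Pr → Formula
  _∧_  : Formula → Formula → Formula
  _∨_  : Formula → Formula → Formula
  _⇒_  : Formula → Formula → Formula
  ¬ᶠ_  : Formula → Formula
  □_   : Formula → Formula
  □L_  : Formula → Formula

record Frame : Set₁ where
  field
    S      : Set
    _≤_    : S → S → Set
    isPO   : IsPartialOrder _≡_ _≤_
    R      : S → S → S → Set
    R-mono : ∀ {s t u s' t' u'} → R s t u → s' ≤ s → t' ≤ t → u ≤ u' → R s' t' u'
    _*     : S → S
    *-anti : ∀ {s t} → s ≤ t → (t *) ≤ (s *)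
    Q      : S → S → Set
    Q-mono : ∀ {s t s' t'} → Q s t → s' ≤ s → t ≤ t' → Q s' t'
    QL     : S → S → Set
    QL-mono : ∀ {s t s' t'} → QL s t → s' ≤ s → t ≤ t' → QL s' t'

UpSet : (F : Frame) → (Frame.S F → Set) → Set
UpSet F X = ∀ {s t} → Frame._≤_ F s t → X s → X t

record Bounded (F : Frame) : Set where
  open Frame F
  field
    𝟘 : S
    𝟙 : S
    𝟘-least    : ∀ s → 𝟘 ≤ s
    𝟙-greatest : ∀ s → s ≤ 𝟙
    𝟙*    : (𝟙 *) ≡ 𝟘
    𝟘*    : (𝟘 *) ≡ 𝟙
    Q00   : Q 𝟘 𝟘
    QL00  : QL 𝟘 𝟘
    Q1    : ∀ s → Q 𝟙 s → s ≡ 𝟙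
    QL1   : ∀ s → QL 𝟙 s → s ≡ 𝟙
    R010  : R 𝟘 𝟙 𝟘
    R1    : ∀ s t → R 𝟙 s t → (s ≡ 𝟘) ⊎ (t ≡ 𝟙)

record IsPossibleWorld (F : Frame) (B : Bounded F) (w : Frame.S F) : Set where
  open Frame F
  open Bounded B
  field
    fixed : (w *) ≡ w
    Rwww  : R w w w
    cond₁ : ∀ s t → R w s t → (s ≡ 𝟘) ⊎ (w ≤ t)
    cond₂ : ∀ s t → R w s t → (t ≡ 𝟙) ⊎ (s ≤ (w *))

record WFrame : Set₁ where
  field
    frame   : Frame
    bounded : Bounded frame
  open Frame frame public
  open Bounded bounded public
  field
    W       : S → Set
    W-pw    : ∀ w → W w → IsPossibleWorld frame bounded w
    W-a     : ∀ w s t u → W w → QL w u → R u s t → s ≤ t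
    W-b     : ∀ s → Σ S (λ w → Σ S (λ u → W w × QL w u × R u s s))

record WModel : Set₁ where
  field
    wframe : WFrame
  open WFrame wframe public
  field
    V      : Pr → S → Set
    V-up   : ∀ p → UpSet frame (V p)
    V-𝟙    : ∀ p → V p 𝟙
    V-𝟘    : ∀ p → ¬ V p 𝟘

module _ (M : WModel) where
  open WModel M

  _⊨_ : S → Formula → Set
  s ⊨ var p    = V p s
  s ⊨ (φ ∧ ψ)  = (s ⊨ φ) × (s ⊨ ψ)
  s ⊨ (φ ∨ ψ)  = (s ⊨ φ) ⊎ (s ⊨ ψ)
  s ⊨ (φ ⇒ ψ)  = ∀ t u → R s t u → t ⊨ φ → u ⊨ ψ
  s ⊨ (¬ᶠ φ)   = ¬ ((s *) ⊨ φ)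
  s ⊨ (□ φ)    = ∀ t → Q s t → t ⊨ φ
  s ⊨ (□L φ)   = ∀ t → QL s t → t ⊨ φ

Sat : (M : WModel) → WModel.S M → Formula → Set
Sat M s φ = _⊨_ M s φ

{-# OPTIONS --safe #-}
module Submission where

-- Truth sets are up-sets containing 𝟙 and avoiding 𝟘. At a possible world w,
-- w * ≡ w makes negation classical, R w w w gives modus ponens, and the two
-- conditions on R w t u say that either t ≡ 𝟘 (so t satisfies nothing) or
-- w ≤ u (so u inherits ψ from w), and either u ≡ 𝟙 (so u satisfies everything)
-- or t ≤ w (so t cannot satisfy a φ that fails at w). Only the passage from
-- w ⊨ φ ⇒ ψ to the disjunction uses excluded middle.

open import Defs
open import Axiom.ExcludedMiddle using (ExcludedMiddle)
open import Data.Product using (_×_; _,_)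
open import Data.Sum using (_⊎_; inj₁; inj₂)
open import Data.Empty using (⊥-elim)
open import Level using (0ℓ)
open import Relation.Nullary using (¬_; yes; no)
open import Function.Bundles using (_⇔_; mk⇔)
open import Relation.Binary.PropositionalEquality using (subst; sym)
open import Relation.Binary.Structures using (IsPartialOrder)

module _ (M : WModel) where
  open WModel M
  open IsPartialOrder isPO using () renaming (refl to ≤-refl)

  Sat-upward : ∀ φ {s t} → s ≤ t → Sat M s φ → Sat M t φ
  Sat-upward (var p) s≤t x = V-up p s≤t x
  Sat-upward (φ ∧ ψ) s≤t (x , y) = Sat-upward φ s≤t x , Sat-upward ψ s≤t y
  Sat-upward (φ ∨ ψ) s≤t (inj₁ x) = inj₁ (Sat-upward φ s≤t x)
  Sat-upward (φ ∨ ψ) s≤t (inj₂ y) = inj₂ (Sat-upward ψ s≤t y)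
  Sat-upward (φ ⇒ ψ) s≤t h u v r = h u v (R-mono r s≤t ≤-refl ≤-refl)
  Sat-upward (¬ᶠ φ) s≤t h x = h (Sat-upward φ (*-anti s≤t) x)
  Sat-upward (□ φ) s≤t h u q = h u (Q-mono q s≤t ≤-refl)
  Sat-upward (□L φ) s≤t h u q = h u (QL-mono q s≤t ≤-refl)

  Sat-𝟙 : ∀ φ → Sat M 𝟙 φ
  ¬Sat-𝟘 : ∀ φ → ¬ Sat M 𝟘 φ

  Sat-𝟙 (var p) = V-𝟙 p
  Sat-𝟙 (φ ∧ ψ) = Sat-𝟙 φ , Sat-𝟙 ψ
  Sat-𝟙 (φ ∨ ψ) = inj₁ (Sat-𝟙 φ)
  Sat-𝟙 (φ ⇒ ψ) t u r x with R1 t u r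
  ... | inj₁ t≡𝟘 = ⊥-elim (¬Sat-𝟘 φ (subst (λ s → Sat M s φ) t≡𝟘 x))
  ... | inj₂ u≡𝟙 = subst (λ s → Sat M s ψ) (sym u≡𝟙) (Sat-𝟙 ψ)
  Sat-𝟙 (¬ᶠ φ) x = ¬Sat-𝟘 φ (subst (λ s → Sat M s φ) 𝟙* x)
  Sat-𝟙 (□ φ) t q = subst (λ s → Sat M s φ) (sym (Q1 t q)) (Sat-𝟙 φ)
  Sat-𝟙 (□L φ) t q = subst (λ s → Sat M s φ) (sym (QL1 t q)) (Sat-𝟙 φ)

  ¬Sat-𝟘 (var p) = V-𝟘 p
  ¬Sat-𝟘 (φ ∧ ψ) (x , _) = ¬Sat-𝟘 φ x
  ¬Sat-𝟘 (φ ∨ ψ) (inj₁ x) = ¬Sat-𝟘 φ x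
  ¬Sat-𝟘 (φ ∨ ψ) (inj₂ y) = ¬Sat-𝟘 ψ y
  ¬Sat-𝟘 (φ ⇒ ψ) h = ¬Sat-𝟘 ψ (h 𝟙 𝟘 R010 (Sat-𝟙 φ))
  ¬Sat-𝟘 (¬ᶠ φ) h = h (subst (λ s → Sat M s φ) (sym 𝟘*) (Sat-𝟙 φ))
  ¬Sat-𝟘 (□ φ) h = ¬Sat-𝟘 φ (h 𝟘 Q00)
  ¬Sat-𝟘 (□L φ) h = ¬Sat-𝟘 φ (h 𝟘 QL00)

  module _ {w : S} (pw : IsPossibleWorld frame bounded w) where
    open IsPossibleWorld pw

    ¬ᶠ-at-world : ∀ φ → Sat M w (¬ᶠ φ) ⇔ (¬ Sat M w φ)
    ¬ᶠ-at-world φ = mk⇔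
      (λ h x → h (subst (λ s → Sat M s φ) (sym fixed) x))
      (λ h x → h (subst (λ s → Sat M s φ) fixed x))

    ⇒-at-world-elim : ∀ φ ψ → Sat M w (φ ⇒ ψ) → Sat M w φ → Sat M w ψ
    ⇒-at-world-elim φ ψ h = h w w Rwww

    ⇒-at-world-intro-consequent : ∀ φ ψ → Sat M w ψ → Sat M w (φ ⇒ ψ)
    ⇒-at-world-intro-consequent φ ψ y t u r x with cond₁ t u r
    ... | inj₁ t≡𝟘 = ⊥-elim (¬Sat-𝟘 φ (subst (λ s → Sat M s φ) t≡𝟘 x))
    ... | inj₂ w≤u = Sat-upward ψ w≤u y

    ⇒-at-world-intro-refuted : ∀ φ ψ → ¬ Sat M w φ → Sat M w (φ ⇒ ψ)
    ⇒-at-world-intro-refuted φ ψ nx t u r x with cond₂ t u r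
    ... | inj₁ u≡𝟙 = subst (λ s → Sat M s ψ) (sym u≡𝟙) (Sat-𝟙 ψ)
    ... | inj₂ t≤w* = ⊥-elim (nx (Sat-upward φ (subst (t ≤_) fixed t≤w*) x))

proposition4p7 : ExcludedMiddle 0ℓ →
    (M : WModel) (w : WModel.S M) →
    IsPossibleWorld (WModel.frame M) (WModel.bounded M) w →
    (φ ψ : Formula) →
      (Sat M w (¬ᶠ φ) ⇔ (¬ Sat M w φ))
      × (Sat M w (φ ⇒ ψ) ⇔ ((¬ Sat M w φ) ⊎ Sat M w ψ))
proposition4p7 lem M w pw φ ψ = ¬ᶠ-at-world M pw φ , mk⇔ classify introduce
  where
  classify : Sat M w (φ ⇒ ψ) → (¬ Sat M w φ) ⊎ Sat M w ψ
  classify h with lem {Sat M w φ}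
  ... | yes x = inj₂ (⇒-at-world-elim M pw φ ψ h x)
  ... | no nx = inj₁ nx

  introduce : (¬ Sat M w φ) ⊎ Sat M w ψ → Sat M w (φ ⇒ ψ)
  introduce (inj₁ nx) = ⇒-at-world-intro-refuted M pw φ ψ nx
  introduce (inj₂ y) = ⇒-at-world-intro-consequent M pw φ ψ y
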